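{- Let $G_1=(V_1,E_1)$ and $G_2=(V_2,E_2)$ be finite simple graphs and let $S_i\subseteq V_i$, $i\in\{1,2\}$. If $S_1\times S_2$ is a $k$-daf set in $G_1\times G_2$ and $S_2$ is a defensive $k'$-alliance in $G_2$, then $S_1$ is a $(k-k')$-daf set in $G_1$.
   Context: For a graph $G=(V,E)$, a set $S\subseteq V$ and $v\in V$, $\delta_S(v)=|\{u\in S: uv\in E\}|$ and $\overline{S}=V\setminus S$. For an integer $k$, a non-empty set $S\subseteq V$ is a defensive $k$-alliance if $\delta_S(v)\ge \delta_{\overline{S}}(v)+k$ for every $v\in S$. A set $X\subseteq V$ is defensive $k$-alliance free ($k$-daf) if $X$ contains no defensive $k$-alliance as a subset. The Cartesian product $G_1\times G_2$ has vertex set $V_1\times V_2$, with $(a,b)$ adjacent to $(c,d)$ iff either $a=c$ and $bd\in E_2$, or $b=d$ and $ac\in E_1$. -}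

module Defs where

open import Data.Bool using (Bool; true; false; _∧_; _∨_; not; T)
open import Data.Nat using (ℕ)
open import Data.Empty using (⊥-elim)
open import Data.Integer using (ℤ; +_; _+_; _-_; _≤_)
open import Data.List using (List; filter; length; cartesianProduct)
open import Data.List.Membership.Propositional using (_∈_)
open import Data.List.Relation.Unary.Unique.Propositional using (Unique)
open import Data.Product using (_×_; _,_; proj₁; proj₂; ∃)
open import Relation.Binary.PropositionalEquality using (_≡_)
open import Relation.Nullary using (¬_)
open import Relation.Nullary.Decidable using (does)
open import Relation.Binary using (DecidableEquality)
open import Relation.Binary.PropositionalEquality using (refl; cong₂)
open import Relation.Nullary using (yes; no)
open import Data.Product.Properties using (≡-dec)
open import Data.Bool.Properties using (∨-comm)
open import Data.List.Relation.Unary.Unique.Propositional.Properties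
  using () renaming (cartesianProduct⁺ to cartesianProduct-Unique)
open import Data.List.Membership.Propositional.Properties using (∈-cartesianProduct⁺)

-- A finite simple graph: a finite vertex type (given by a duplicate-free
-- exhaustive enumeration), decidable equality, and a Boolean adjacency
-- relation that is symmetric and irreflexive (no loops, no multi-edges).
record Graph : Set₁ where
  field
    V        : Set
    _≟_      : DecidableEquality V
    verts    : List V
    unique   : Unique verts
    complete : ∀ v → v ∈ verts
    adj      : V → V → Bool
    sym      : ∀ u v → adj u v ≡ adj v u
    irrefl   : ∀ v → adj v v ≡ false

open Graph public

Subset : Graph → Set
Subset G = V G → Bool

Mem : (G : Graph) → V G → Subset G → Set
Mem G v S = T (S v)

compl : (G : Graph) → Subset G → Subset G
compl G S v = not (S v)

Sub : (G : Graph) → Subset G → Subset G → Set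
Sub G X Y = ∀ (v : V G) → Mem G v X → Mem G v Y

NonEmpty : (G : Graph) → Subset G → Set
NonEmpty G S = ∃ λ (v : V G) → Mem G v S

δ : (G : Graph) → Subset G → V G → ℕ
δ G S v = length (filter (λ u → T? (S u ∧ adj G u v)) (verts G))
  where
    open import Data.Bool.Properties using (T?)

DefensiveAlliance : (G : Graph) → ℤ → Subset G → Set
DefensiveAlliance G k S =
  NonEmpty G S ×
  (∀ (v : V G) → Mem G v S → (+ δ G (compl G S) v) + k ≤ + δ G S v)

DAF : (G : Graph) → ℤ → Subset G → Set
DAF G k X = ∀ (S : Subset G) → Sub G S X → ¬ DefensiveAlliance G k S

-- Cartesian product G₁ × G₂ (written G₁ □ G₂):
-- (a,b) ~ (c,d)  iff  (a = c and bd ∈ E₂) or (b = d and ac ∈ E₁).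
module _ (G₁ G₂ : Graph) where
  private
    eq₁ : V G₁ → V G₁ → Bool
    eq₁ a c = does (_≟_ G₁ a c)
    eq₂ : V G₂ → V G₂ → Bool
    eq₂ b d = does (_≟_ G₂ b d)

    eq₁-sym : ∀ a c → eq₁ a c ≡ eq₁ c a
    eq₁-sym a c with _≟_ G₁ a c | _≟_ G₁ c a
    ... | yes _ | yes _ = refl
    ... | no _ | no _ = refl
    ... | yes refl | no ¬p = ⊥-elim (¬p refl)
    ... | no ¬p | yes refl = ⊥-elim (¬p refl)

    eq₂-sym : ∀ b d → eq₂ b d ≡ eq₂ d b
    eq₂-sym b d with _≟_ G₂ b d | _≟_ G₂ d b
    ... | yes _ | yes _ = refl
    ... | no _ | no _ = refl
    ... | yes refl | no ¬p = ⊥-elim (¬p refl)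
    ... | no ¬p | yes refl = ⊥-elim (¬p refl)

    padj : V G₁ × V G₂ → V G₁ × V G₂ → Bool
    padj (a , b) (c , d) = (eq₁ a c ∧ adj G₂ b d) ∨ (eq₂ b d ∧ adj G₁ a c)

    padj-sym : ∀ u v → padj u v ≡ padj v u
    padj-sym (a , b) (c , d) =
      cong₂ _∨_ (cong₂ _∧_ (eq₁-sym a c) (sym G₂ b d))
                (cong₂ _∧_ (eq₂-sym b d) (sym G₁ a c))

    padj-irrefl : ∀ v → padj v v ≡ false
    padj-irrefl (a , b) rewrite irrefl G₁ a | irrefl G₂ b
      with eq₁ a a | eq₂ b b
    ... | false | false = refl
    ... | false | true = refl
    ... | true | false = refl
    ... | true | true = refl

  _□_ : Graph
  _□_ = record
    { V        = V G₁ × V G₂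
    ; _≟_      = ≡-dec (_≟_ G₁) (_≟_ G₂)
    ; verts    = cartesianProduct (verts G₁) (verts G₂)
    ; unique   = cartesianProduct-Unique (unique G₁) (unique G₂)
    ; complete = λ { (a , b) → ∈-cartesianProduct⁺ (complete G₁ a) (complete G₂ b) }
    ; adj      = padj
    ; sym      = padj-sym
    ; irrefl   = padj-irrefl
    }

prodSet : (G₁ G₂ : Graph) → Subset G₁ → Subset G₂ → Subset (G₁ □ G₂)
prodSet G₁ G₂ S₁ S₂ (a , b) = S₁ a ∧ S₂ b

module Submission where

-- Suppose S ⊆ S₁ were a defensive (k - k′)-alliance of G₁.  In the
-- Cartesian product every neighbour of (a , b) differs from it in exactly one
-- coordinate, so for any vertex set P of G₁ □ G₂
--     δ_P(a , b) = δ_{P(a , ·)}(b) + δ_{P(· , b)}(a).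
-- For a product set S × S₂ and (a , b) ∈ S × S₂ the two sections are S₂ and S,
-- and likewise for the complement, so the alliance inequalities of S (at a)
-- and S₂ (at b) add up to the alliance inequality of S × S₂ at (a , b): the
-- product of a k₁-alliance and a k₂-alliance is a (k₁ + k₂)-alliance.  Hence
-- S × S₂ is a k-alliance contained in S₁ × S₂, contradicting k-freeness.

open import Defs hiding (sym)
open import Data.Bool using (Bool; true; false; _∧_; _∨_; not)
open import Data.Bool.Properties using (T?; T-≡; T-∧; ∧-zeroʳ; ∧-identityʳ)
open import Data.Nat as ℕ using (ℕ; suc)
import Data.Nat.Properties as ℕ
open import Data.Integer as ℤ using (ℤ; +_; _-_)
import Data.Integer.Properties as ℤ
open import Data.Integer.Tactic.RingSolver using (solve-∀)
open import Algebra.Properties.CommutativeSemigroup ℕ.+-commutativeSemigroup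
  using () renaming (interchange to +-interchange)
open import Function using (_∘_; Equivalence)
open Equivalence using (to; from)
open import Data.List using (List; []; _∷_; _++_; map; filter; length; cartesianProduct)
open import Data.List.Membership.Propositional using (_∈_)
open import Data.List.Relation.Unary.Any using (here; there)
open import Data.List.Relation.Unary.All as All using (All; []; _∷_)
open import Data.List.Relation.Unary.AllPairs using (_∷_)
open import Data.List.Relation.Unary.Unique.Propositional using (Unique)
open import Data.Product using (_×_; _,_)
open import Relation.Binary.PropositionalEquality
open import Relation.Nullary using (¬_; yes; no; does)
open import Relation.Nullary.Decidable using (dec-true; dec-false)

sumBy : ∀ {A : Set} → (A → ℕ) → List A → ℕ
sumBy g []       = 0
sumBy g (x ∷ xs) = g x ℕ.+ sumBy g xs

sumBy-cong : ∀ {A : Set} {g h : A → ℕ} → (∀ x → g x ≡ h x) →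
  ∀ xs → sumBy g xs ≡ sumBy h xs
sumBy-cong g≗h []       = refl
sumBy-cong g≗h (x ∷ xs) = cong₂ ℕ._+_ (g≗h x) (sumBy-cong g≗h xs)

sumBy-+ : ∀ {A : Set} (g h : A → ℕ) xs →
  sumBy (λ x → g x ℕ.+ h x) xs ≡ sumBy g xs ℕ.+ sumBy h xs
sumBy-+ g h []       = refl
sumBy-+ g h (x ∷ xs) = begin
  g x ℕ.+ h x ℕ.+ sumBy (λ y → g y ℕ.+ h y) xs  ≡⟨ cong (g x ℕ.+ h x ℕ.+_) (sumBy-+ g h xs) ⟩
  g x ℕ.+ h x ℕ.+ (sumBy g xs ℕ.+ sumBy h xs)   ≡⟨ +-interchange (g x) (h x) _ _ ⟩
  g x ℕ.+ sumBy g xs ℕ.+ (h x ℕ.+ sumBy h xs)   ∎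
  where open ≡-Reasoning

sumBy-++ : ∀ {A : Set} (g : A → ℕ) xs ys →
  sumBy g (xs ++ ys) ≡ sumBy g xs ℕ.+ sumBy g ys
sumBy-++ g []       ys = refl
sumBy-++ g (x ∷ xs) ys =
  trans (cong (g x ℕ.+_) (sumBy-++ g xs ys)) (sym (ℕ.+-assoc (g x) _ _))

sumBy-map : ∀ {A B : Set} (g : B → ℕ) (f : A → B) xs →
  sumBy g (map f xs) ≡ sumBy (λ x → g (f x)) xs
sumBy-map g f []       = refl
sumBy-map g f (x ∷ xs) = cong (g (f x) ℕ.+_) (sumBy-map g f xs)

sumBy-cartesianProduct : ∀ {A B : Set} (g : A × B → ℕ) xs ys →
  sumBy g (cartesianProduct xs ys) ≡ sumBy (λ x → sumBy (λ y → g (x , y)) ys) xs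
sumBy-cartesianProduct g []       ys = refl
sumBy-cartesianProduct g (x ∷ xs) ys =
  trans (sumBy-++ g (map (x ,_) ys) (cartesianProduct xs ys))
        (cong₂ ℕ._+_ (sumBy-map g (x ,_) ys) (sumBy-cartesianProduct g xs ys))

sumBy-zero : ∀ {A : Set} {g : A → ℕ} {xs} → All (λ x → g x ≡ 0) xs → sumBy g xs ≡ 0
sumBy-zero []         = refl
sumBy-zero {g = g} {x ∷ xs} (gx≡0 ∷ ps) = trans (cong (ℕ._+ sumBy g xs) gx≡0) (sumBy-zero ps)

sumBy-concentrated : ∀ {A : Set} {xs : List A} {a : A} → Unique xs → a ∈ xs →
  (g : A → ℕ) → (∀ x → ¬ x ≡ a → g x ≡ 0) → sumBy g xs ≡ g a
sumBy-concentrated (a∉xs ∷ _) (here refl) g vanish =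
  trans (cong (g _ ℕ.+_) (sumBy-zero {g = g} (All.map (λ a≢x → vanish _ (a≢x ∘ sym)) a∉xs)))
        (ℕ.+-identityʳ _)
sumBy-concentrated {xs = _ ∷ xs} (x∉xs ∷ u) (there a∈xs) g vanish =
  trans (cong (ℕ._+ sumBy g xs) (vanish _ (All.lookup x∉xs a∈xs))) (sumBy-concentrated u a∈xs g vanish)

sumOverVertices-at : (G : Graph) (a : V G) (g : V G → ℕ) →
  (∀ c → ¬ c ≡ a → g c ≡ 0) → sumBy g (verts G) ≡ g a
sumOverVertices-at G a = sumBy-concentrated (unique G) (complete G a)

ind : Bool → ℕ
ind true  = 1
ind false = 0

length-filter : ∀ {A : Set} (f : A → Bool) xs →
  length (filter (λ u → T? (f u)) xs) ≡ sumBy (λ u → ind (f u)) xs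
length-filter f [] = refl
length-filter f (x ∷ xs) with f x
... | true  = cong suc (length-filter f xs)
... | false = length-filter f xs

ind-∧-∨ : ∀ x p q → p ∧ q ≡ false → ind (x ∧ (p ∨ q)) ≡ ind (x ∧ p) ℕ.+ ind (x ∧ q)
ind-∧-∨ false p     q     _ = refl
ind-∧-∨ true  true  false _ = refl
ind-∧-∨ true  false q     _ = refl

δ-cong : (G : Graph) {S S′ : Subset G} → (∀ u → S u ≡ S′ u) → ∀ v → δ G S v ≡ δ G S′ v
δ-cong G {S} {S′} S≗S′ v = begin
  δ G S v                                         ≡⟨ length-filter _ (verts G) ⟩
  sumBy (λ u → ind (S u ∧ adj G u v)) (verts G)   ≡⟨ sumBy-cong (λ u → cong (λ s → ind (s ∧ adj G u v)) (S≗S′ u)) (verts G) ⟩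
  sumBy (λ u → ind (S′ u ∧ adj G u v)) (verts G)  ≡⟨ length-filter _ (verts G) ⟨
  δ G S′ v                                        ∎
  where open ≡-Reasoning

module ProductDegree (G₁ G₂ : Graph) where

  _≡₁_ : V G₁ → V G₁ → Bool
  c ≡₁ a = does (_≟_ G₁ c a)

  _≡₂_ : V G₂ → V G₂ → Bool
  d ≡₂ b = does (_≟_ G₂ d b)

  row : Subset (G₁ □ G₂) → V G₁ → Subset G₂
  row P a d = P (a , d)

  column : Subset (G₁ □ G₂) → V G₂ → Subset G₁
  column P b c = P (c , b)

  -- The two kinds of product edges never hold simultaneously: equal first
  -- coordinates would make the second kind a loop of G₁.
  edge-kinds-disjoint : ∀ c d a b →
    (c ≡₁ a ∧ adj G₂ d b) ∧ (d ≡₂ b ∧ adj G₁ c a) ≡ false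
  edge-kinds-disjoint c d a b with _≟_ G₁ c a
  ... | no _     = refl
  ... | yes refl rewrite irrefl G₁ c | ∧-zeroʳ (d ≡₂ b) = ∧-zeroʳ (adj G₂ d b)

  rowNeighbour : Subset (G₁ □ G₂) → V G₁ → V G₂ → V G₁ × V G₂ → Bool
  rowNeighbour P a b (c , d) = P (c , d) ∧ (c ≡₁ a ∧ adj G₂ d b)

  columnNeighbour : Subset (G₁ □ G₂) → V G₁ → V G₂ → V G₁ × V G₂ → Bool
  columnNeighbour P a b (c , d) = P (c , d) ∧ (d ≡₂ b ∧ adj G₁ c a)

  count-rowNeighbours : ∀ P a b →
    sumBy (λ u → ind (rowNeighbour P a b u)) (verts (G₁ □ G₂)) ≡ δ G₂ (row P a) b
  count-rowNeighbours P a b = begin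
    sumBy (λ u → ind (rowNeighbour P a b u)) (verts (G₁ □ G₂))
      ≡⟨ sumBy-cartesianProduct _ (verts G₁) (verts G₂) ⟩
    sumBy rowSum (verts G₁)
      ≡⟨ sumOverVertices-at G₁ a rowSum offRow ⟩
    rowSum a
      ≡⟨ sumBy-cong onRow (verts G₂) ⟩
    sumBy (λ d → ind (P (a , d) ∧ adj G₂ d b)) (verts G₂)
      ≡⟨ length-filter _ (verts G₂) ⟨
    δ G₂ (row P a) b
      ∎
    where
    open ≡-Reasoning
    rowSum : V G₁ → ℕ
    rowSum c = sumBy (λ d → ind (rowNeighbour P a b (c , d))) (verts G₂)

    offRow : ∀ c → ¬ c ≡ a → rowSum c ≡ 0
    offRow c c≢a = sumBy-zero {xs = verts G₂} (All.tabulate (λ {d} _ → vanish d))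
      where
      vanish : ∀ d → ind (rowNeighbour P a b (c , d)) ≡ 0
      vanish d rewrite dec-false (_≟_ G₁ c a) c≢a | ∧-zeroʳ (P (c , d)) = refl

    onRow : ∀ d → ind (rowNeighbour P a b (a , d)) ≡ ind (P (a , d) ∧ adj G₂ d b)
    onRow d rewrite dec-true (_≟_ G₁ a a) refl = refl

  count-columnNeighbours : ∀ P a b →
    sumBy (λ u → ind (columnNeighbour P a b u)) (verts (G₁ □ G₂)) ≡ δ G₁ (column P b) a
  count-columnNeighbours P a b = begin
    sumBy (λ u → ind (columnNeighbour P a b u)) (verts (G₁ □ G₂))
      ≡⟨ sumBy-cartesianProduct _ (verts G₁) (verts G₂) ⟩
    sumBy (λ c → sumBy (λ d → ind (columnNeighbour P a b (c , d))) (verts G₂)) (verts G₁)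
      ≡⟨ sumBy-cong columnSum (verts G₁) ⟩
    sumBy (λ c → ind (P (c , b) ∧ adj G₁ c a)) (verts G₁)
      ≡⟨ length-filter _ (verts G₁) ⟨
    δ G₁ (column P b) a
      ∎
    where
    open ≡-Reasoning
    offColumn : ∀ c d → ¬ d ≡ b → ind (columnNeighbour P a b (c , d)) ≡ 0
    offColumn c d d≢b rewrite dec-false (_≟_ G₂ d b) d≢b | ∧-zeroʳ (P (c , d)) = refl

    onColumn : ∀ c → ind (columnNeighbour P a b (c , b)) ≡ ind (P (c , b) ∧ adj G₁ c a)
    onColumn c rewrite dec-true (_≟_ G₂ b b) refl = refl

    columnSum : ∀ c →
      sumBy (λ d → ind (columnNeighbour P a b (c , d))) (verts G₂) ≡ ind (P (c , b) ∧ adj G₁ c a)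
    columnSum c = trans (sumOverVertices-at G₂ b _ (offColumn c)) (onColumn c)

  δ-product : ∀ P a b → δ (G₁ □ G₂) P (a , b) ≡ δ G₂ (row P a) b ℕ.+ δ G₁ (column P b) a
  δ-product P a b = begin
    δ (G₁ □ G₂) P (a , b)
      ≡⟨ length-filter _ (verts (G₁ □ G₂)) ⟩
    sumBy (λ u → ind (P u ∧ adj (G₁ □ G₂) u (a , b))) (verts (G₁ □ G₂))
      ≡⟨ sumBy-cong splitEdge (verts (G₁ □ G₂)) ⟩
    sumBy (λ u → ind (rowNeighbour P a b u) ℕ.+ ind (columnNeighbour P a b u)) (verts (G₁ □ G₂))
      ≡⟨ sumBy-+ _ _ (verts (G₁ □ G₂)) ⟩
    sumBy (λ u → ind (rowNeighbour P a b u)) (verts (G₁ □ G₂))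
      ℕ.+ sumBy (λ u → ind (columnNeighbour P a b u)) (verts (G₁ □ G₂))
      ≡⟨ cong₂ ℕ._+_ (count-rowNeighbours P a b) (count-columnNeighbours P a b) ⟩
    δ G₂ (row P a) b ℕ.+ δ G₁ (column P b) a
      ∎
    where
    open ≡-Reasoning
    splitEdge : ∀ u → ind (P u ∧ adj (G₁ □ G₂) u (a , b))
                      ≡ ind (rowNeighbour P a b u) ℕ.+ ind (columnNeighbour P a b u)
    splitEdge (c , d) = ind-∧-∨ (P (c , d)) _ _ (edge-kinds-disjoint c d a b)

  module _ {S₁ : Subset G₁} {S₂ : Subset G₂} {a : V G₁} {b : V G₂}
           (a∈S₁ : S₁ a ≡ true) (b∈S₂ : S₂ b ≡ true) where

    row-prodSet : ∀ d → row (prodSet G₁ G₂ S₁ S₂) a d ≡ S₂ d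
    row-prodSet d = cong (_∧ S₂ d) a∈S₁

    column-prodSet : ∀ c → column (prodSet G₁ G₂ S₁ S₂) b c ≡ S₁ c
    column-prodSet c = trans (cong (S₁ c ∧_) b∈S₂) (∧-identityʳ (S₁ c))

    δ-prodSet : δ (G₁ □ G₂) (prodSet G₁ G₂ S₁ S₂) (a , b) ≡ δ G₂ S₂ b ℕ.+ δ G₁ S₁ a
    δ-prodSet = trans (δ-product _ a b)
      (cong₂ ℕ._+_ (δ-cong G₂ row-prodSet b) (δ-cong G₁ column-prodSet a))

    δ-compl-prodSet : δ (G₁ □ G₂) (compl (G₁ □ G₂) (prodSet G₁ G₂ S₁ S₂)) (a , b)
                      ≡ δ G₂ (compl G₂ S₂) b ℕ.+ δ G₁ (compl G₁ S₁) a
    δ-compl-prodSet = trans (δ-product _ a b)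
      (cong₂ ℕ._+_ (δ-cong G₂ (cong not ∘ row-prodSet) b)
                   (δ-cong G₁ (cong not ∘ column-prodSet) a))

alliance-inequality-+ : ∀ {x₁ y₁ x₂ y₂ : ℕ} (k₁ k₂ : ℤ) →
  + x₁ ℤ.+ k₁ ℤ.≤ + y₁ → + x₂ ℤ.+ k₂ ℤ.≤ + y₂ →
  + (x₂ ℕ.+ x₁) ℤ.+ (k₁ ℤ.+ k₂) ℤ.≤ + (y₂ ℕ.+ y₁)
alliance-inequality-+ {x₁} {y₁} {x₂} {y₂} k₁ k₂ ineq₁ ineq₂ =
  subst₂ ℤ._≤_ regroup (sym (ℤ.pos-+ y₂ y₁)) (ℤ.+-mono-≤ ineq₂ ineq₁)
  where
  rearrange : ∀ (i j l m : ℤ) → (i ℤ.+ l) ℤ.+ (j ℤ.+ m) ≡ (i ℤ.+ j) ℤ.+ (m ℤ.+ l)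
  rearrange = solve-∀

  regroup : (+ x₂ ℤ.+ k₂) ℤ.+ (+ x₁ ℤ.+ k₁) ≡ + (x₂ ℕ.+ x₁) ℤ.+ (k₁ ℤ.+ k₂)
  regroup = trans (rearrange (+ x₂) (+ x₁) k₂ k₁)
                  (cong (ℤ._+ (k₁ ℤ.+ k₂)) (sym (ℤ.pos-+ x₂ x₁)))

alliance-product : ∀ {G₁ G₂ : Graph} {S₁ : Subset G₁} {S₂ : Subset G₂} {k₁ k₂ : ℤ} →
  DefensiveAlliance G₁ k₁ S₁ → DefensiveAlliance G₂ k₂ S₂ →
  DefensiveAlliance (G₁ □ G₂) (k₁ ℤ.+ k₂) (prodSet G₁ G₂ S₁ S₂)
alliance-product {G₁} {G₂} {S₁} {S₂} {k₁} {k₂} ((a , a∈S₁) , defends₁) ((b , b∈S₂) , defends₂) =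
  ((a , b) , from T-∧ (a∈S₁ , b∈S₂)) , defends
  where
  open ProductDegree G₁ G₂
  defends : ∀ v → Mem (G₁ □ G₂) v (prodSet G₁ G₂ S₁ S₂) →
    + δ (G₁ □ G₂) (compl (G₁ □ G₂) (prodSet G₁ G₂ S₁ S₂)) v ℤ.+ (k₁ ℤ.+ k₂)
      ℤ.≤ + δ (G₁ □ G₂) (prodSet G₁ G₂ S₁ S₂) v
  defends (c , d) cd∈S with to T-∧ cd∈S
  ... | c∈S₁ , d∈S₂ =
    subst₂ (λ x y → + x ℤ.+ (k₁ ℤ.+ k₂) ℤ.≤ + y)
      (sym (δ-compl-prodSet (to T-≡ c∈S₁) (to T-≡ d∈S₂)))
      (sym (δ-prodSet (to T-≡ c∈S₁) (to T-≡ d∈S₂)))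
      (alliance-inequality-+ k₁ k₂ (defends₁ c c∈S₁) (defends₂ d d∈S₂))

prodSet-monoˡ : ∀ {G₁ G₂ : Graph} {S S₁ : Subset G₁} (S₂ : Subset G₂) →
  Sub G₁ S S₁ → Sub (G₁ □ G₂) (prodSet G₁ G₂ S S₂) (prodSet G₁ G₂ S₁ S₂)
prodSet-monoˡ S₂ S⊆S₁ (a , b) ab∈S×S₂ with to T-∧ ab∈S×S₂
... | a∈S , b∈S₂ = from T-∧ (S⊆S₁ a a∈S , b∈S₂)

theorem7 : (G₁ G₂ : Graph) (S₁ : Subset G₁) (S₂ : Subset G₂) (k k′ : ℤ) →
    DAF (G₁ □ G₂) k (prodSet G₁ G₂ S₁ S₂) →
    DefensiveAlliance G₂ k′ S₂ →
    DAF G₁ (k - k′) S₁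
theorem7 G₁ G₂ S₁ S₂ k k′ S₁×S₂-free S₂-alliance S S⊆S₁ S-alliance =
  S₁×S₂-free (prodSet G₁ G₂ S S₂) (prodSet-monoˡ {G₁} {G₂} S₂ S⊆S₁)
    (subst (λ l → DefensiveAlliance (G₁ □ G₂) l (prodSet G₁ G₂ S S₂))
           (minus-plus k k′)
           (alliance-product {G₁} {G₂} {S} {S₂} {k - k′} S-alliance S₂-alliance))
  where
  minus-plus : ∀ (i j : ℤ) → (i - j) ℤ.+ j ≡ i
  minus-plus = solve-∀
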